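{- Let $N$ be an arboreal network. (i) If $N$ contains a vertex of outdegree at least 2 that is not a root, then $\mathcal A(N)$ contains a cycle of length 3 (a triangle). (ii) If $N$ has a vertex of outdegree at least 3, then $\mathcal A(N)$ contains a triangle.
   Context: In a digraph, a leaf is a vertex of indegree 1 and outdegree 0, a root is a vertex of indegree 0. A network on a finite set $X$ ($|X|\ge2$) is a simple acyclic digraph $N$ whose underlying undirected graph is connected, whose set of leaves is $X$, in which every vertex of indegree 0 has outdegree at least 2, every vertex of outdegree 0 has indegree 1, and no vertex has both indegree and outdegree equal to 1. $N$ is arboreal if its underlying undirected graph is a tree. $\mathcal A(N)$ is the graph on $X$ in which distinct $x,y$ are adjacent iff some vertex of $N$ has directed paths (possibly of length 0) to both. -}

module Defs where

open import Data.Nat using (ℕ; _≤_; _≥_; _<_)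
open import Data.Fin using (Fin)
open import Data.Bool using (Bool; true; false; T)
open import Data.List using (List; []; _∷_; length; filterᵇ; allFin)
open import Data.List.Relation.Unary.Unique.Propositional using (Unique)
open import Data.List.Relation.Binary.Pointwise using ()
open import Data.Product using (Σ; ∃; ∃-syntax; _×_; _,_)
open import Data.Sum using (_⊎_)
open import Relation.Nullary using (¬_)
open import Relation.Binary.PropositionalEquality using (_≡_; _≢_)
open import Relation.Binary.Construct.Closure.ReflexiveTransitive using (Star)

-- A relation has no parallel arcs, so "simple" only additionally requires no loops.
-- last element of the nonempty list x ∷ xs
lastOf : ∀ {A : Set} → A → List A → A
lastOf x [] = x
lastOf x (y ∷ ys) = lastOf y ys

record Digraph : Set where
  field
    n   : ℕ
    arc : Fin n → Fin n → Bool

module _ (G : Digraph) where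
  open Digraph G

  Vertex : Set
  Vertex = Fin n

  Arc : Vertex → Vertex → Set
  Arc u v = T (arc u v)

  indeg : Vertex → ℕ
  indeg v = length (filterᵇ (λ u → arc u v) (allFin n))

  outdeg : Vertex → ℕ
  outdeg v = length (filterᵇ (λ w → arc v w) (allFin n))

  IsLeaf : Vertex → Set
  IsLeaf v = indeg v ≡ 1 × outdeg v ≡ 0

  IsRoot : Vertex → Set
  IsRoot v = indeg v ≡ 0

  data DPath : Vertex → Vertex → Set where
    here : ∀ {u} → DPath u u
    step : ∀ {u w v} → Arc u w → DPath w v → DPath u v

  NoLoops : Set
  NoLoops = ∀ v → ¬ Arc v v

  Acyclic : Set
  Acyclic = ∀ u v → Arc u v → ¬ DPath v u

  UAdj : Vertex → Vertex → Set
  UAdj u v = Arc u v ⊎ Arc v u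

  UConnected : Set
  UConnected = ∀ u v → Star UAdj u v

  data Walk : List Vertex → Set where
    one  : ∀ {v} → Walk (v ∷ [])
    cons : ∀ {u v vs} → UAdj u v → Walk (v ∷ vs) → Walk (u ∷ v ∷ vs)

  UCycle : Set
  UCycle = Σ Vertex λ v₀ → Σ (List Vertex) λ rest →
             3 ≤ length (v₀ ∷ rest) × Unique (v₀ ∷ rest) × Walk (v₀ ∷ rest)
             × UAdj (lastOf v₀ rest) v₀

  IsArboreal : Set
  IsArboreal = UConnected × ¬ UCycle

  record IsNetwork : Set where
    field
      simple          : NoLoops
      acyclic         : Acyclic
      connected       : UConnected
      twoLeaves       : Σ Vertex λ x → Σ Vertex λ y → x ≢ y × IsLeaf x × IsLeaf y
      indeg0⇒outdeg≥2 : ∀ v → indeg v ≡ 0 → outdeg v ≥ 2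
      outdeg0⇒indeg1  : ∀ v → outdeg v ≡ 0 → indeg v ≡ 1
      no-1-1          : ∀ v → ¬ (indeg v ≡ 1 × outdeg v ≡ 1)

  AAdj : Vertex → Vertex → Set
  AAdj x y = IsLeaf x × IsLeaf y × x ≢ y × Σ Vertex λ w → DPath w x × DPath w y

  ATriangle : Set
  ATriangle = Σ Vertex λ x → Σ Vertex λ y → Σ Vertex λ z →
                AAdj x y × AAdj y z × AAdj x z

{-# OPTIONS --safe #-}
module Submission where

-- If a vertex a has two distinct children b₁, b₂ with a common descendant z, then
-- following a path from b₂ towards z until it first meets a path from b₁ to z, and
-- closing up through a, yields an undirected cycle.  So in an arboreal network leaves
-- below distinct children of a vertex are distinct, and adjacent in A(N) through that
-- vertex.  Three children of one vertex thus give a triangle at once.  For a non-root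
-- v with children w₁, w₂, a root r above v has a second child k off the path towards
-- v, and the leaves below w₁, w₂ and k form a triangle.

open import Defs
open import Level using (Level)
open import Data.Nat using (ℕ; _≤_; _≥_; _<_; z≤n; s≤s)
open import Data.Fin using (Fin)
open import Data.Fin.Induction using (spo-noetherian)
open import Data.Fin.Properties using (_≟_)
open import Data.Bool using (Bool; T)
open import Data.List using (List; []; _∷_; _++_; length; filterᵇ; allFin)
open import Data.List.Relation.Unary.All as All using (All; []; _∷_)
open import Data.List.Relation.Unary.AllPairs using ([]; _∷_)
open import Data.List.Relation.Unary.Any using (here; there)
open import Data.List.Relation.Unary.Unique.Propositional using (Unique)
import Data.List.Relation.Unary.Unique.Propositional.Properties as Unique
open import Data.List.Relation.Binary.Disjoint.Propositional using (Disjoint)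
open import Data.List.Membership.Propositional using (_∈_)
open import Data.List.Membership.Propositional.Properties using (∈-filter⁻)
import Data.List.Membership.DecPropositional as DecMembership
open import Data.Product using (Σ; ∃; ∃₂; _×_; _,_; proj₁; proj₂)
open import Data.Sum using (_⊎_; inj₁; inj₂)
open import Function using (flip; id)
open import Induction.WellFounded using (WellFounded; Acc; acc; module Subrelation)
open import Relation.Nullary using (¬_; yes; no; contradiction)
open import Relation.Nullary.Decidable using (T?)
open import Relation.Unary using (Pred; Decidable; ∁)
open import Data.List.Relation.Binary.Subset.Propositional using (_⊆_)
open import Relation.Binary using (Rel; IsStrictPartialOrder)
open import Relation.Binary.PropositionalEquality
  using (_≡_; _≢_; refl; sym; cong; subst; isEquivalence)
open import Relation.Binary.Construct.Closure.ReflexiveTransitive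
  using (Star; ε; _◅_; _◅◅_) renaming (reverse to reverseStar)

private
  variable
    ℓ ℓ′ : Level
    A : Set

lastOf-++ : (x : A) (xs : List A) (y : A) (ys : List A) →
            lastOf x (xs ++ y ∷ ys) ≡ lastOf y ys
lastOf-++ x []       y ys = refl
lastOf-++ x (x′ ∷ xs) y ys = lastOf-++ x′ xs y ys

length-++-∷-positive : (xs : List A) {y : A} {ys : List A} → 0 < length (xs ++ y ∷ ys)
length-++-∷-positive []      = s≤s z≤n
length-++-∷-positive (_ ∷ _) = s≤s z≤n

two-distinct : {xs : List A} → Unique xs → 2 ≤ length xs →
               ∃₂ λ x y → x ≢ y × x ∈ xs × y ∈ xs
two-distinct {xs = x ∷ y ∷ _} ((x≢y ∷ _) ∷ _) _ = x , y , x≢y , here refl , there (here refl)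
two-distinct {xs = _ ∷ []} _ (s≤s ())

three-distinct : {xs : List A} → Unique xs → 3 ≤ length xs →
                 Σ A λ x → Σ A λ y → Σ A λ z → x ≢ y × y ≢ z × x ≢ z × x ∈ xs × y ∈ xs × z ∈ xs
three-distinct {xs = x ∷ y ∷ z ∷ _} ((x≢y ∷ x≢z ∷ _) ∷ (y≢z ∷ _) ∷ _) _ =
  x , y , z , x≢y , y≢z , x≢z , here refl , there (here refl) , there (there (here refl))
three-distinct {xs = _ ∷ []}     _ (s≤s ())
three-distinct {xs = _ ∷ _ ∷ []} _ (s≤s (s≤s ()))

empty-or-member : (xs : List A) → xs ≡ [] ⊎ ∃ (_∈ xs)
empty-or-member []      = inj₁ refl
empty-or-member (x ∷ _) = inj₂ (x , here refl)

module _ {n : ℕ} (f : Fin n → Bool) where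

  ∈-filterᵇ-allFin⁻ : ∀ {x} → x ∈ filterᵇ f (allFin n) → T (f x)
  ∈-filterᵇ-allFin⁻ x∈ = proj₂ (∈-filter⁻ (λ x → T? (f x)) {xs = allFin n} x∈)

  filterᵇ-allFin-unique : Unique (filterᵇ f (allFin n))
  filterᵇ-allFin-unique = Unique.filter⁺ (λ x → T? (f x)) (Unique.allFin⁺ n)

module _ {R : Rel A ℓ} where

  trail : ∀ {x y} → Star R x y → List A
  trail ε                 = []
  trail (_◅_ {j = w} _ s) = w ∷ trail s

  vertices : ∀ {x y} → Star R x y → List A
  vertices {x} s = x ∷ trail s

  lastOf-trail : ∀ {x y} (s : Star R x y) → lastOf x (trail s) ≡ y
  lastOf-trail ε           = refl
  lastOf-trail (_ ◅ ε)     = refl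
  lastOf-trail (_ ◅ r ◅ s) = lastOf-trail (r ◅ s)

  end∈vertices : ∀ {x y} (s : Star R x y) → y ∈ vertices s
  end∈vertices ε       = here refl
  end∈vertices (_ ◅ s) = there (end∈vertices s)

  prefix : ∀ {x y z} (s : Star R x y) → z ∈ vertices s →
           Σ (Star R x z) λ s′ → vertices s′ ⊆ vertices s
  prefix s       (here refl) = ε , λ { (here refl) → here refl }
  prefix (r ◅ s) (there z∈)  with prefix s z∈
  ... | s′ , s′⊆s = r ◅ s′ , λ { (here refl) → here refl ; (there v∈) → there (s′⊆s v∈) }

  suffix : ∀ {x y z} (s : Star R x y) → z ∈ vertices s → Star R z y
  suffix s       (here refl) = s
  suffix (_ ◅ s) (there z∈)  = suffix s z∈

  module _ (acyclic : ∀ {x y} → R x y → ¬ Star R y x) where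

    vertices-unique : ∀ {x y} (s : Star R x y) → Unique (vertices s)
    vertices-unique ε       = [] ∷ []
    vertices-unique (r ◅ s) =
      All.tabulate (λ { z∈ refl → acyclic r (proj₁ (prefix s z∈)) }) ∷ vertices-unique s

-- Walk along s while staying outside S; on entering S, return the arc of entry
-- together with the part walked so far, reversed.
module _ {R : Rel A ℓ} {S : Pred A ℓ′} (S? : Decidable S) where

  Entry : A → Set _
  Entry u = ∃₂ λ c w → Σ (Star (flip R) c u) λ r → All (∁ S) (vertices r) × R c w × S w

  first-entry : ∀ {u z} → Star R u z → S z → S u ⊎ Entry u
  first-entry {u} {z} s Sz with S? u
  ... | yes Su = inj₁ Su
  ... | no ¬Su = inj₂ (walk ε (¬Su ∷ []) s)
    where
    walk : ∀ {c} (r : Star (flip R) c u) → All (∁ S) (vertices r) → Star R c z → Entry u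
    walk r outside ε = contradiction Sz (All.head outside)
    walk r outside (_◅_ {j = w} cw s) with S? w
    ... | yes Sw = _ , w , r , outside , cw , Sw
    ... | no ¬Sw = walk (cw ◅ r) (¬Sw ∷ outside) s

module _ {n : ℕ} {R : Rel (Fin n) ℓ} (acyclic : ∀ {x y} → R x y → ¬ Star R y x) where

  noetherian : WellFounded (flip R)
  noetherian = Subrelation.wellFounded {_<₂_ = flip _⊏_} (λ r → _ , r , ε)
                 (spo-noetherian isStrictPartialOrder)
    where
    _⊏_ : Rel (Fin n) _
    x ⊏ y = ∃ λ w → R x w × Star R w y

    isStrictPartialOrder : IsStrictPartialOrder _≡_ _⊏_
    isStrictPartialOrder = record
      { isEquivalence = isEquivalence
      ; irrefl        = λ { refl (_ , r , s) → acyclic r s }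
      ; trans         = λ { (_ , r , s) (_ , r′ , s′) → _ , r , (s ◅◅ (r′ ◅ s′)) }
      ; <-resp-≈      = (λ { refl x⊏y → x⊏y }) , (λ { refl x⊏y → x⊏y })
      }

  descend : {P : Pred (Fin n) ℓ′} → (∀ u → P u ⊎ ∃ (R u)) → ∀ u → ∃ λ x → Star R u x × P x
  descend {P = P} progress u = go (noetherian u)
    where
    go : ∀ {u} → Acc (flip R) u → ∃ λ x → Star R u x × P x
    go {u} (acc rs) with progress u
    ... | inj₁ Pu      = u , ε , Pu
    ... | inj₂ (w , r) with go (rs r)
    ...   | x , s , Px = x , r ◅ s , Px

module _ (N : Digraph) where
  open Digraph N using (n; arc)
  open DecMembership (_≟_ {n}) using (_∈?_)

  children parents : Vertex N → List (Vertex N)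
  children v = filterᵇ (arc v) (allFin n)
  parents v  = filterᵇ (λ u → arc u v) (allFin n)

  Star⇒DPath : ∀ {u v} → Star (Arc N) u v → DPath N u v
  Star⇒DPath ε       = here
  Star⇒DPath (r ◅ s) = step r (Star⇒DPath s)

  walk : {R : Rel (Vertex N) ℓ} → (∀ {x y} → R x y → UAdj N x y) →
         ∀ {x y} (s : Star R x y) → Walk N (vertices s)
  walk R⇒UAdj ε       = one
  walk R⇒UAdj (r ◅ s) = cons (R⇒UAdj r) (walk R⇒UAdj s)

  walk-++ : ∀ {x xs y ys} → Walk N (x ∷ xs) → UAdj N (lastOf x xs) y → Walk N (y ∷ ys) →
            Walk N (x ∷ xs ++ y ∷ ys)
  walk-++ one             x~y wy = cons x~y wy
  walk-++ (cons x~x′ wxs) x~y wy = cons x~x′ (walk-++ wxs x~y wy)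

  join⇒UCycle : ∀ {x xs y ys} → Walk N (x ∷ xs) → Walk N (y ∷ ys) →
                Unique (x ∷ xs) → Unique (y ∷ ys) → Disjoint (x ∷ xs) (y ∷ ys) →
                UAdj N (lastOf x xs) y → UAdj N (lastOf y ys) x →
                3 ≤ length (x ∷ xs ++ y ∷ ys) → UCycle N
  join⇒UCycle {x} {xs} {y} {ys} wx wy ux uy disjoint x~y y~x len =
    x , xs ++ y ∷ ys , len , Unique.++⁺ ux uy disjoint , walk-++ wx x~y wy ,
    subst (λ t → UAdj N t x) (sym (lastOf-++ x xs y ys)) y~x

  module _ (acyclic : Acyclic N) where

    arc-acyclic : ∀ {x y} → Arc N x y → ¬ Star (Arc N) y x
    arc-acyclic xy s = acyclic _ _ xy (Star⇒DPath s)

    coarc-acyclic : ∀ {x y} → Arc N y x → ¬ Star (flip (Arc N)) y x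
    coarc-acyclic yx s = arc-acyclic yx (reverseStar id s)

    detour⇒UCycle : ∀ {a b₁ b₂} → Arc N a b₁ → Arc N a b₂ → b₁ ≢ b₂ →
                    Star (Arc N) b₁ b₂ → UCycle N
    detour⇒UCycle {a} {b₁} {b₂} ab₁ ab₂ b₁≢b₂ p =
      join⇒UCycle one (walk inj₁ p) ([] ∷ []) (vertices-unique arc-acyclic p)
        (λ { (here refl , a∈p) → arc-acyclic ab₁ (proj₁ (prefix p a∈p)) })
        (inj₁ ab₁) (subst (λ t → UAdj N t a) (sym (lastOf-trail p)) (inj₂ ab₂)) (long p)
      where
      long : (s : Star (Arc N) b₁ b₂) → 3 ≤ length (a ∷ vertices s)
      long ε       = contradiction refl b₁≢b₂
      long (_ ◅ _) = s≤s (s≤s (s≤s z≤n))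

    branches⇒UCycle : ∀ {a b₁ b₂ c w} → Arc N a b₁ → Arc N a b₂ →
                      (p : Star (Arc N) b₁ w) (r : Star (flip (Arc N)) c b₂) → Arc N c w →
                      Disjoint (vertices p) (vertices r) → UCycle N
    branches⇒UCycle {a} {c = c} ab₁ ab₂ p r cw p∩r=∅ =
      join⇒UCycle (walk inj₁ (ab₁ ◅ p)) (walk inj₂ r)
        (vertices-unique arc-acyclic (ab₁ ◅ p)) (vertices-unique coarc-acyclic r) disjoint
        (subst (λ t → UAdj N t c) (sym (lastOf-trail p)) (inj₂ cw))
        (subst (λ t → UAdj N t a) (sym (lastOf-trail r)) (inj₂ ab₂))
        (s≤s (s≤s (length-++-∷-positive (trail p))))
      where
      disjoint : Disjoint (a ∷ vertices p) (vertices r)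
      disjoint (here refl , a∈r)  = arc-acyclic ab₂ (reverseStar id (suffix r a∈r))
      disjoint (there v∈p , v∈r) = p∩r=∅ (v∈p , v∈r)

    common-descendant⇒UCycle : ∀ {a b₁ b₂ z} → Arc N a b₁ → Arc N a b₂ → b₁ ≢ b₂ →
                               Star (Arc N) b₁ z → Star (Arc N) b₂ z → UCycle N
    common-descendant⇒UCycle ab₁ ab₂ b₁≢b₂ p q
      with first-entry (_∈? vertices p) q (end∈vertices p)
    ... | inj₁ b₂∈p = detour⇒UCycle ab₁ ab₂ b₁≢b₂ (proj₁ (prefix p b₂∈p))
    ... | inj₂ (_ , _ , r , r∉p , cw , w∈p) with prefix p w∈p
    ...   | p′ , p′⊆p =
      branches⇒UCycle ab₁ ab₂ p′ r cw (λ (v∈p′ , v∈r) → All.lookup r∉p v∈r (p′⊆p v∈p′))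

  module Arboreal (network : IsNetwork N) (no-cycle : ¬ UCycle N) where
    open IsNetwork network

    ∈-children⇒Arc : ∀ {v w} → w ∈ children v → Arc N v w
    ∈-children⇒Arc = ∈-filterᵇ-allFin⁻ _

    child-or-leaf : ∀ u → IsLeaf N u ⊎ ∃ (Arc N u)
    child-or-leaf u with empty-or-member (children u)
    ... | inj₁ none     = inj₁ (outdeg0⇒indeg1 u (cong length none) , cong length none)
    ... | inj₂ (w , w∈) = inj₂ (w , ∈-children⇒Arc w∈)

    parent-or-root : ∀ u → IsRoot N u ⊎ ∃ λ w → Arc N w u
    parent-or-root u with empty-or-member (parents u)
    ... | inj₁ none     = inj₁ (cong length none)
    ... | inj₂ (w , w∈) = inj₂ (w , ∈-filterᵇ-allFin⁻ _ w∈)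

    leaf-below : ∀ u → ∃ λ x → Star (Arc N) u x × IsLeaf N x
    leaf-below = descend (arc-acyclic acyclic) child-or-leaf

    root-above : ∀ u → ∃ λ r → Star (Arc N) r u × IsRoot N r
    root-above u with descend (coarc-acyclic acyclic) parent-or-root u
    ... | r , s , root = r , reverseStar id s , root

    two-children : ∀ v → outdeg N v ≥ 2 → ∃₂ λ w₁ w₂ → w₁ ≢ w₂ × Arc N v w₁ × Arc N v w₂
    two-children v deg with two-distinct (filterᵇ-allFin-unique (arc v)) deg
    ... | w₁ , w₂ , w₁≢w₂ , w₁∈ , w₂∈ = w₁ , w₂ , w₁≢w₂ , ∈-children⇒Arc w₁∈ , ∈-children⇒Arc w₂∈

    child-other-than : ∀ {r} c → outdeg N r ≥ 2 → ∃ λ k → c ≢ k × Arc N r k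
    child-other-than {r} c deg with two-children r deg
    ... | w₁ , w₂ , w₁≢w₂ , rw₁ , rw₂ with c ≟ w₁
    ...   | yes refl = w₂ , w₁≢w₂ , rw₂
    ...   | no c≢w₁  = w₁ , c≢w₁ , rw₁

    siblings⇒AAdj : ∀ {v w₁ w₂ x₁ x₂} → Arc N v w₁ → Arc N v w₂ → w₁ ≢ w₂ →
                    Star (Arc N) w₁ x₁ → Star (Arc N) w₂ x₂ → IsLeaf N x₁ → IsLeaf N x₂ →
                    AAdj N x₁ x₂
    siblings⇒AAdj {v} vw₁ vw₂ w₁≢w₂ s₁ s₂ leaf₁ leaf₂ =
      leaf₁ , leaf₂ ,
      (λ { refl → no-cycle (common-descendant⇒UCycle acyclic vw₁ vw₂ w₁≢w₂ s₁ s₂) }) ,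
      v , Star⇒DPath (vw₁ ◅ s₁) , Star⇒DPath (vw₂ ◅ s₂)

    non-root-branching⇒ATriangle : (Σ (Vertex N) λ v → outdeg N v ≥ 2 × ¬ IsRoot N v) →
                                   ATriangle N
    non-root-branching⇒ATriangle (v , deg , non-root) with two-children v deg | root-above v
    ... | _ , _ , _ , _ , _ | _ , ε , root = contradiction root non-root
    ... | w₁ , w₂ , w₁≢w₂ , vw₁ , vw₂ | r , _◅_ {j = c} rc c⇝v , root
      with child-other-than c (indeg0⇒outdeg≥2 r root)
    ... | k , c≢k , rk with leaf-below w₁ | leaf-below w₂ | leaf-below k
    ... | x₁ , s₁ , leaf₁ | x₂ , s₂ , leaf₂ | y , t , leafʸ =
      x₁ , x₂ , y ,
      siblings⇒AAdj vw₁ vw₂ w₁≢w₂ s₁ s₂ leaf₁ leaf₂ ,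
      siblings⇒AAdj rc rk c≢k (c⇝v ◅◅ (vw₂ ◅ s₂)) t leaf₂ leafʸ ,
      siblings⇒AAdj rc rk c≢k (c⇝v ◅◅ (vw₁ ◅ s₁)) t leaf₁ leafʸ

    three-children⇒ATriangle : (Σ (Vertex N) λ v → outdeg N v ≥ 3) → ATriangle N
    three-children⇒ATriangle (v , deg) with three-distinct (filterᵇ-allFin-unique (arc v)) deg
    ... | w₁ , w₂ , w₃ , w₁≢w₂ , w₂≢w₃ , w₁≢w₃ , w₁∈ , w₂∈ , w₃∈
      with ∈-children⇒Arc w₁∈ | ∈-children⇒Arc w₂∈ | ∈-children⇒Arc w₃∈
    ... | vw₁ | vw₂ | vw₃ with leaf-below w₁ | leaf-below w₂ | leaf-below w₃
    ... | x₁ , s₁ , leaf₁ | x₂ , s₂ , leaf₂ | x₃ , s₃ , leaf₃ =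
      x₁ , x₂ , x₃ ,
      siblings⇒AAdj vw₁ vw₂ w₁≢w₂ s₁ s₂ leaf₁ leaf₂ ,
      siblings⇒AAdj vw₂ vw₃ w₂≢w₃ s₂ s₃ leaf₂ leaf₃ ,
      siblings⇒AAdj vw₁ vw₃ w₁≢w₃ s₁ s₃ leaf₁ leaf₃

lemma6p1 : (N : Digraph) → IsNetwork N → IsArboreal N →
    ((Σ (Vertex N) λ v → outdeg N v ≥ 2 × ¬ IsRoot N v) → ATriangle N)
    × ((Σ (Vertex N) λ v → outdeg N v ≥ 3) → ATriangle N)
lemma6p1 N network (_ , no-cycle) =
  non-root-branching⇒ATriangle , three-children⇒ATriangle
  where open Arboreal N network no-cycle
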